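{- Let $G$ be a connected finite $\delta$-hyperbolic graph. For any vertices $x,y,v$ and any vertex $c\in I(x,y)$: (i) if $d(x,c)\le (v|y)_x$, then $d(c,v)\le d(x,v)-d(x,c)+2\delta$ and $d(c,v)\le d(x,v)+\delta$; moreover, when $v\in F(c)$, $e(c)\le e(x)-d(x,c)+2\delta$ and $e(c)\le e(x)+\delta$. (ii) If $d(y,c)\le (v|x)_y$, i.e., $d(x,c)\ge (v|y)_x$, then $d(c,v)\le d(y,v)-d(y,c)+2\delta$ and $d(c,v)\le d(y,v)+\delta$; moreover, when $v\in F(c)$, $e(c)\le e(y)-d(y,c)+2\delta$ and $e(c)\le e(y)+\delta$.
   Context: $d$ is the shortest-path distance; $G$ is $\delta$-hyperbolic if for any four vertices $u,v,w,x$ the two larger of $d(u,v)+d(w,x)$, $d(u,w)+d(v,x)$, $d(u,x)+d(v,w)$ differ by at most $2\delta$. $I(x,y)=\{z: d(x,z)+d(z,y)=d(x,y)\}$. Gromov product: $(x|y)_z=\frac12(d(x,z)+d(y,z)-d(x,y))$. $e(v)=\max_u d(v,u)$, $F(v)=\{u: d(u,v)=e(v)\}$. -}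

module Defs where

open import Data.Nat using (ℕ; zero; suc; _+_; _*_; _∸_; _≤_; _⊔_; _⊓_)
open import Data.Fin using (Fin)
open import Data.List using (foldr; map; allFin)
open import Data.Product using (_×_; ∃)
open import Relation.Nullary using (¬_)
open import Relation.Binary.PropositionalEquality using (_≡_)

record Graph (n : ℕ) : Set₁ where
  field
    Adj        : Fin n → Fin n → Set
    adj-sym    : ∀ {u v} → Adj u v → Adj v u
    adj-irrefl : ∀ {u} → ¬ Adj u u

module _ {n : ℕ} (G : Graph n) where
  open Graph G

  data Walk : Fin n → Fin n → ℕ → Set where
    here : ∀ {u} → Walk u u 0
    step : ∀ {u w v k} → Adj u w → Walk w v k → Walk u v (suc k)

  Connected : Set
  Connected = ∀ u v → ∃ λ k → Walk u v k

  IsDistance : (Fin n → Fin n → ℕ) → Set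
  IsDistance d = ∀ u v → Walk u v (d u v) × (∀ k → Walk u v k → d u v ≤ k)

module _ {n : ℕ} (d : Fin n → Fin n → ℕ) where

  max3 : ℕ → ℕ → ℕ → ℕ
  max3 a b c = a ⊔ b ⊔ c

  med3 : ℕ → ℕ → ℕ → ℕ
  med3 a b c = (a ⊓ b) ⊔ (a ⊓ c) ⊔ (b ⊓ c)

  -- δ-hyperbolicity with δ = h/2 (h = 2δ ∈ ℕ): for all u v w x, the two larger of
  -- d(u,v)+d(w,x), d(u,w)+d(v,x), d(u,x)+d(v,w) differ by at most 2δ = h.
  Hyperbolic2 : ℕ → Set
  Hyperbolic2 h = ∀ u v w x →
    let A = d u v + d w x
        B = d u w + d v x
        C = d u x + d v w
    in max3 A B C ≤ med3 A B C + h

  InInterval : Fin n → Fin n → Fin n → Set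
  InInterval x y z = d x z + d z y ≡ d x y

  -- Twice the Gromov product: 2 (a|b)_z = d(a,z) + d(b,z) - d(a,b)
  gromov2 : Fin n → Fin n → Fin n → ℕ
  gromov2 a b z = d a z + d b z ∸ d a b

  ecc : Fin n → ℕ
  ecc v = foldr _⊔_ 0 (map (d v) (allFin n))

  InF : Fin n → Fin n → Set
  InF v u = d u v ≡ ecc v

-- Assume 2 d(x,c) ≤ 2 (v|y)_x.  Since c lies on a geodesic from x to y this says
-- d(x,c) + d(y,v) ≤ d(x,v) + d(y,c), i.e. in the four-point condition for x, y, v, c
-- the sum d(x,c) + d(y,v) is not the largest; hence the remaining sum
-- d(x,y) + d(c,v) exceeds d(x,v) + d(y,c) by at most 2δ.  Substituting
-- d(x,y) = d(x,c) + d(c,y) gives d(c,v) + d(x,c) ≤ d(x,v) + 2δ, and adding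
-- d(c,v) ≤ d(c,x) + d(x,v) gives 2 d(c,v) ≤ 2 d(x,v) + 2δ.  For v ∈ F(c) the left
-- sides are eccentricities of c while d(x,v) ≤ e(x).  Part (ii) is part (i) with
-- x and y exchanged.
module Submission where

open import Defs
open import Data.Nat using (ℕ; suc; _+_; _*_; _≤_; _⊔_; _⊓_)
open import Data.Nat.Properties
open import Data.Nat.Solver using (module +-*-Solver)
open import Data.Fin using (Fin)
open import Data.List using (List; _∷_; foldr; map)
open import Data.List.Membership.Propositional using (_∈_)
open import Data.List.Membership.Propositional.Properties using (∈-allFin)
open import Data.List.Relation.Unary.Any using (here; there)
open import Data.Product using (_×_; _,_; proj₁; proj₂)
open import Data.Sum using (inj₁; inj₂)
open import Relation.Binary.PropositionalEquality
open +-*-Solver using (solve; _:+_; _:*_; _:=_; con)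

f≤foldr-⊔ : ∀ {A : Set} (f : A → ℕ) {xs : List A} {v} → v ∈ xs → f v ≤ foldr _⊔_ 0 (map f xs)
f≤foldr-⊔ f {x ∷ _} (here refl) = m≤m⊔n (f x) _
f≤foldr-⊔ f {x ∷ _} (there v∈xs) = ≤-trans (f≤foldr-⊔ f v∈xs) (m≤n⊔m (f x) _)

d≤ecc : ∀ {n} (d : Fin n → Fin n → ℕ) x v → d x v ≤ ecc d x
d≤ecc d x v = f≤foldr-⊔ (d x) (∈-allFin v)

max≤med+h⇒≤+h : ∀ {a b c h} → c ≤ b →
  a ⊔ b ⊔ c ≤ (a ⊓ b) ⊔ (a ⊓ c) ⊔ (b ⊓ c) + h → a ≤ b + h
max≤med+h⇒≤+h {a} {b} {c} {h} c≤b spread with ≤-total a b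
... | inj₁ a≤b = ≤-trans a≤b (m≤m+n b h)
... | inj₂ b≤a = begin
  a                                    ≤⟨ ≤-trans (m≤m⊔n a b) (m≤m⊔n (a ⊔ b) c) ⟩
  a ⊔ b ⊔ c                            ≤⟨ spread ⟩
  (a ⊓ b) ⊔ (a ⊓ c) ⊔ (b ⊓ c) + h      ≤⟨ +-monoˡ-≤ h med≤b ⟩
  b + h                                ∎
  where
  open ≤-Reasoning
  med≤b : (a ⊓ b) ⊔ (a ⊓ c) ⊔ (b ⊓ c) ≤ b
  med≤b = ⊔-lub (⊔-lub (m⊓n≤n a b) (≤-trans (m⊓n≤n a c) c≤b)) (m⊓n≤m b c)

module _ {n : ℕ} {G : Graph n} where
  open Graph G

  Walk-snoc : ∀ {u w v k} → Walk G u w k → Adj w v → Walk G u v (suc k)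
  Walk-snoc here       a = step a here
  Walk-snoc (step b p) a = step b (Walk-snoc p a)

  Walk-reverse : ∀ {u v k} → Walk G u v k → Walk G v u k
  Walk-reverse here       = here
  Walk-reverse (step a p) = Walk-snoc (Walk-reverse p) (adj-sym a)

  Walk-++ : ∀ {u w v k m} → Walk G u w k → Walk G w v m → Walk G u v (k + m)
  Walk-++ here       q = q
  Walk-++ (step a p) q = step a (Walk-++ p q)

  module Distance {d : Fin n → Fin n → ℕ} (isd : IsDistance G d) where

    d-sym : ∀ u v → d u v ≡ d v u
    d-sym u v = ≤-antisym (proj₂ (isd u v) _ (Walk-reverse (proj₁ (isd v u))))
                          (proj₂ (isd v u) _ (Walk-reverse (proj₁ (isd u v))))

    d-triangle : ∀ u w v → d u v ≤ d u w + d w v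
    d-triangle u w v = proj₂ (isd u v) _ (Walk-++ (proj₁ (isd u w)) (proj₁ (isd w v)))

    InInterval-sym : ∀ {x y c} → InInterval d x y c → InInterval d y x c
    InInterval-sym {x} {y} {c} I = begin
      d y c + d c x  ≡⟨ cong₂ _+_ (d-sym y c) (d-sym c x) ⟩
      d c y + d x c  ≡⟨ +-comm (d c y) (d x c) ⟩
      d x c + d c y  ≡⟨ I ⟩
      d x y          ≡⟨ d-sym x y ⟩
      d y x          ∎
      where open ≡-Reasoning

    gromov2+d≡d+d : ∀ v y x → gromov2 d v y x + d v y ≡ d v x + d y x
    gromov2+d≡d+d v y x = m∸n+n≡m (begin
      d v y          ≤⟨ d-triangle v x y ⟩
      d v x + d x y  ≡⟨ cong (d v x +_) (d-sym x y) ⟩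
      d v x + d y x  ∎)
      where open ≤-Reasoning

    near-x⇒sum-not-largest : ∀ {x y v c} → InInterval d x y c →
      2 * d x c ≤ gromov2 d v y x → d x c + d y v ≤ d x v + d y c
    near-x⇒sum-not-largest {x} {y} {v} {c} I H = +-cancelˡ-≤ (d x c) _ _ (begin
      d x c + (d x c + d y v)   ≡⟨ shuffleˡ (d x c) ⟩
      2 * d x c + d v y         ≤⟨ +-monoˡ-≤ (d v y) H ⟩
      gromov2 d v y x + d v y   ≡⟨ gromov2+d≡d+d v y x ⟩
      d v x + d y x             ≡⟨ cong₂ _+_ (d-sym v x) (trans (d-sym y x) (sym I)) ⟩
      d x v + (d x c + d c y)   ≡⟨ shuffleʳ (d x c) ⟩
      d x c + (d x v + d y c)   ∎)
      where
      open ≤-Reasoning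
      shuffleˡ : ∀ a → a + (a + d y v) ≡ 2 * a + d v y
      shuffleˡ a = trans (solve 2 (λ a r → a :+ (a :+ r) := con 2 :* a :+ r) refl a (d y v))
                   (cong (2 * a +_) (d-sym y v))
      shuffleʳ : ∀ a → d x v + (a + d c y) ≡ a + (d x v + d y c)
      shuffleʳ a = trans (solve 3 (λ p a b → p :+ (a :+ b) := a :+ (p :+ b)) refl (d x v) a (d c y))
                   (cong (λ w → a + (d x v + w)) (d-sym c y))

    module _ {h : ℕ} (hyp : Hyperbolic2 d h) where

      near-x⇒d-bound : ∀ {x y v c} → InInterval d x y c →
        2 * d x c ≤ gromov2 d v y x → d c v + d x c ≤ d x v + h
      near-x⇒d-bound {x} {y} {v} {c} I H = +-cancelʳ-≤ (d c y) _ _ (begin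
        d c v + d x c + d c y   ≡⟨ solve 3 (λ e a b → e :+ a :+ b := a :+ b :+ e) refl (d c v) (d x c) (d c y) ⟩
        d x c + d c y + d c v   ≡⟨ cong₂ _+_ I (d-sym c v) ⟩
        d x y + d v c           ≤⟨ max≤med+h⇒≤+h (near-x⇒sum-not-largest I H) (hyp x y v c) ⟩
        d x v + d y c + h       ≡⟨ cong (λ w → d x v + w + h) (d-sym y c) ⟩
        d x v + d c y + h       ≡⟨ solve 3 (λ p b h → p :+ b :+ h := p :+ h :+ b) refl (d x v) (d c y) h ⟩
        d x v + h + d c y       ∎)
        where open ≤-Reasoning

      near-x⇒2d-bound : ∀ {x y v c} → InInterval d x y c →
        2 * d x c ≤ gromov2 d v y x → 2 * d c v ≤ 2 * d x v + h
      near-x⇒2d-bound {x} {y} {v} {c} I H = +-cancelʳ-≤ (d x c) _ _ (begin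
        2 * d c v + d x c           ≡⟨ solve 2 (λ e a → con 2 :* e :+ a := e :+ (e :+ a)) refl (d c v) (d x c) ⟩
        d c v + (d c v + d x c)     ≤⟨ +-mono-≤ (d-triangle c x v) (near-x⇒d-bound I H) ⟩
        d c x + d x v + (d x v + h) ≡⟨ cong (λ w → w + d x v + (d x v + h)) (d-sym c x) ⟩
        d x c + d x v + (d x v + h) ≡⟨ solve 3 (λ a p h → a :+ p :+ (p :+ h) := con 2 :* p :+ h :+ a) refl (d x c) (d x v) h ⟩
        2 * d x v + h + d x c       ∎)
        where open ≤-Reasoning

      near-x⇒bounds : ∀ {x y v c} → InInterval d x y c →
        2 * d x c ≤ gromov2 d v y x →
          (d c v + d x c ≤ d x v + h)
        × (2 * d c v ≤ 2 * d x v + h)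
        × (InF d c v →
             (ecc d c + d x c ≤ ecc d x + h)
           × (2 * ecc d c ≤ 2 * ecc d x + h))
      near-x⇒bounds {x} {y} {v} {c} I H = d-bound , 2d-bound , ecc-bounds
        where
        d-bound : d c v + d x c ≤ d x v + h
        d-bound = near-x⇒d-bound I H
        2d-bound : 2 * d c v ≤ 2 * d x v + h
        2d-bound = near-x⇒2d-bound I H
        ecc-bounds : InF d c v → (ecc d c + d x c ≤ ecc d x + h) × (2 * ecc d c ≤ 2 * ecc d x + h)
        ecc-bounds v∈F rewrite sym (trans (d-sym c v) v∈F) =
            ≤-trans d-bound (+-monoˡ-≤ h (d≤ecc d x v))
          , ≤-trans 2d-bound (+-monoˡ-≤ h (*-monoʳ-≤ 2 (d≤ecc d x v)))

lemma2 : ∀ {n : ℕ} (G : Graph n) → Connected G →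
         (d : Fin n → Fin n → ℕ) → IsDistance G d →
         (h : ℕ) → Hyperbolic2 d h →
         ∀ (x y v c : Fin n) → InInterval d x y c →
         ((2 * d x c ≤ gromov2 d v y x →
             (d c v + d x c ≤ d x v + h)
           × (2 * d c v ≤ 2 * d x v + h)
           × (InF d c v →
                (ecc d c + d x c ≤ ecc d x + h)
              × (2 * ecc d c ≤ 2 * ecc d x + h)))
         × (2 * d y c ≤ gromov2 d v x y →
             (d c v + d y c ≤ d y v + h)
           × (2 * d c v ≤ 2 * d y v + h)
           × (InF d c v →
                (ecc d c + d y c ≤ ecc d y + h)
              × (2 * ecc d c ≤ 2 * ecc d y + h))))
lemma2 G _ d isd h hyp x y v c I = near-x⇒bounds hyp I , near-x⇒bounds hyp (InInterval-sym I)
  where open Distance isd
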